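{- For a complete multipartite graph $G$ with $\lambda\ge 2$, $\mathrm{nim}(\mathrm{DNG}(G))=\mathrm{pty}(\lambda+\sigma)$.
   Context: $G=K_{m_1,\ldots,m_k}$ is a complete multipartite graph with $k\ge 2$ parts and $m_1\le\cdots\le m_k$; $\sigma:=|\{i\mid m_i=1\}|$ and $\lambda:=|\{i\mid m_i\ge 2\}|$ are the numbers of one-vertex parts and of parts with at least two vertices. For a graph $G=(V,E)$, a set of vertices is geodetically convex if it contains every vertex on every shortest path between two of its vertices; the convex hull $[P]$ is the smallest convex set containing $P$, and $P$ is generating if $[P]=V$. In the avoidance game $\mathrm{DNG}(G)$, two players alternately select previously-unselected vertices such that the selected set never generates; the player who cannot move loses. $\mathrm{nim}$ denotes the nim-number of an impartial game, and $\mathrm{pty}(k):=k\bmod 2$. -}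

module Defs where

open import Level using (Level; Lift; lift) renaming (zero to lzero; suc to lsuc)
open import Data.Nat using (ℕ; zero; suc; _≤_; _<_; _+_; _%_; _≟_; _≤?_)
open import Data.Fin using (Fin)
open import Data.List using (List; []; _∷_; length; lookup; filter)
open import Data.Nat.ListAction using (sum)
open import Data.List.Membership.Propositional using (_∈_; _∉_)
open import Data.Product using (Σ; _×_; proj₁; ∃-syntax)
open import Relation.Nullary using (¬_)
open import Relation.Binary.PropositionalEquality using (_≡_; _≢_)

module _ {V : Set} (Adj : V → V → Set) where

  data Walk : V → V → ℕ → Set where
    nil  : ∀ {u} → Walk u u 0
    cons : ∀ {u w v l} → Adj u w → Walk w v l → Walk u v (suc l)

  data OnWalk (x : V) : ∀ {u v l} → Walk u v l → Set where
    here  : ∀ {v l} {w : Walk x v l} → OnWalk x w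
    there : ∀ {u w v l} {a : Adj u w} {p : Walk w v l} → OnWalk x p → OnWalk x (cons a p)

  -- A shortest path (geodesic) from u to v: a walk of minimum length
  -- (shortest walks are automatically paths).
  IsShortest : ∀ {u v l} → Walk u v l → Set
  IsShortest {u} {v} {l} _ = ∀ {l'} → Walk u v l' → l ≤ l'

  Convex : (V → Set) → Set
  Convex C = ∀ u v → C u → C v → ∀ {l} (p : Walk u v l) → IsShortest p →
             ∀ x → OnWalk x p → C x

  -- P generates: its convex hull [P] (smallest convex superset) is all of V,
  -- i.e. every convex set containing P is all of V.
  Generating : List V → Set₁
  Generating P = ∀ (C : V → Set) → Convex C → (∀ x → x ∈ P → C x) → ∀ x → C x

  -- Legal move in DNG from position P (selected vertices): pick an unselected
  -- vertex v such that the new selected set does not generate.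
  DNGMove : List V → V → Set₁
  DNGMove P v = (v ∉ P) × ¬ Generating (v ∷ P)

  -- NimDNG f P g : the nim-number (Sprague–Grundy value, mex of option values)
  -- of DNG at position P is g, computed with recursion fuel f.  With
  -- f ≥ number of unselected vertices, this is the true nim-number.
  NimDNG : ℕ → List V → ℕ → Set₁
  NimDNG zero    P g = Lift (lsuc lzero) (g ≡ 0)
  NimDNG (suc f) P g =
    (∀ v → DNGMove P v → ∀ h → NimDNG f (v ∷ P) h → h ≢ g) ×
    (∀ h → h < g → Σ V λ v → DNGMove P v × NimDNG f (v ∷ P) h)

-- Complete multipartite graph K_{m_1,...,m_k}, given by the list of part sizes.

CMVertex : List ℕ → Set
CMVertex ms = Σ (Fin (length ms)) λ i → Fin (lookup ms i)

CMAdj : (ms : List ℕ) → CMVertex ms → CMVertex ms → Set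
CMAdj ms u v = proj₁ u ≢ proj₁ v

order : List ℕ → ℕ
order = sum

sigma : List ℕ → ℕ
sigma ms = length (filter (_≟ 1) ms)

lam : List ℕ → ℕ
lam ms = length (filter (2 ≤?_) ms)

pty : ℕ → ℕ
pty k = k % 2

NimDNGCM : List ℕ → ℕ → Set₁
NimDNGCM ms g = NimDNG (CMAdj ms) (order ms) [] g

-- If λ ≥ 2, a set of vertices generates as soon as it contains two vertices of one
-- part: every vertex outside that part lies on a geodesic of length 2 between them,
-- and a second part with two vertices then brings back the first part as well.
-- Conversely a set meeting each part at most once is convex and, as some part has
-- two vertices, not generating. So the positions of DNG are exactly the partial
-- transversals of the parts, and every play ends after exactly k = λ + σ moves.
module Submission where

open import Defs
open import Data.Nat using (ℕ; _≤_; _+_)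
open import Data.List using (List; length)
open import Data.List.Relation.Unary.All using (All)
open import Data.Nat.Properties using (≤-totalOrder)
open import Data.List.Relation.Unary.Sorted.TotalOrder ≤-totalOrder using (Sorted)

open import Data.Nat using (zero; suc; _<_; z≤n; s≤s; _≤?_)
open import Data.Nat.Properties using (≤-trans; ≤-pred; ≰⇒>; <⇒≱; <-irrefl; <-cmp; +-suc; +-identityʳ; m<m+n; +-mono-≤)
open import Data.List using ([]; _∷_; lookup)
import Data.List.Relation.Unary.All as All
open import Data.List.Relation.Unary.Any using (here; there; index)
open import Data.List.Relation.Unary.Any.Properties using (lookup-index)
open import Data.List.Membership.Propositional using (_∈_; _∉_)
open import Data.List.Membership.Propositional.Properties using (∈-lookup)
open import Data.Fin using (Fin; fromℕ<) renaming (zero to fzero; suc to fsuc)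
open import Data.Fin.Properties using (_≟_; any?; all?; injective⇒≤; suc-injective)
open import Data.Product using (Σ; ∃; ∃₂; _×_; _,_; proj₁; proj₂)
open import Data.Sum using (_⊎_; inj₁; inj₂)
open import Data.Empty using (⊥-elim)
open import Function.Definitions using (Injective)
open import Relation.Nullary using (¬_; ¬?; yes; no; contradiction)
open import Relation.Binary.PropositionalEquality
open import Relation.Binary.Definitions using (tri<; tri≈; tri>)
open import Level using (lift)

pty-suc≢ : ∀ n → pty (suc n) ≢ pty n
pty-suc≢ zero ()
pty-suc≢ (suc zero) ()
pty-suc≢ (suc (suc n)) = pty-suc≢ n

<pty-suc⇒≡pty : ∀ {h} n → h < pty (suc n) → h ≡ pty n
<pty-suc⇒≡pty zero (s≤s z≤n) = refl
<pty-suc⇒≡pty (suc (suc n)) h< = <pty-suc⇒≡pty n h<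

<⇒∃-outsideImage : ∀ {m n} → m < n → (f : Fin m → Fin n) → ∃ λ i → ∀ j → f j ≢ i
<⇒∃-outsideImage m<n f with any? (λ i → all? (λ j → ¬? (f j ≟ i)))
... | yes found = found
... | no none = contradiction (injective⇒≤ preimage-injective) (<⇒≱ m<n)
  where
    preimage : ∀ i → ∃ λ j → f j ≡ i
    preimage i with any? (λ j → f j ≟ i)
    ... | yes hit = hit
    ... | no unhit = ⊥-elim (none (i , λ j fj≡i → unhit (j , fj≡i)))

    preimage-injective : Injective _≡_ _≡_ (λ i → proj₁ (preimage i))
    preimage-injective {i} {i′} eq =
      trans (sym (proj₂ (preimage i))) (trans (cong f eq) (proj₂ (preimage i′)))

2≤⇒∃-distinct : ∀ {n} → 2 ≤ n → ∃₂ λ (a b : Fin n) → a ≢ b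
2≤⇒∃-distinct (s≤s (s≤s z≤n)) = fzero , fsuc fzero , λ ()

module _ {V : Set} {Adj : V → V → Set} where

  shortest≤1 : ∀ {u v l} (p : Walk Adj u v l) → u ≡ v ⊎ Adj u v → IsShortest Adj p → l ≤ 1
  shortest≤1 _ (inj₁ refl) shortest = ≤-trans (shortest nil) z≤n
  shortest≤1 _ (inj₂ a) shortest = shortest (cons a nil)

  walk≤1⇒≡⊎Adj : ∀ {u v l} → Walk Adj u v l → l ≤ 1 → u ≡ v ⊎ Adj u v
  walk≤1⇒≡⊎Adj nil _ = inj₁ refl
  walk≤1⇒≡⊎Adj (cons a nil) _ = inj₂ a
  walk≤1⇒≡⊎Adj (cons _ (cons _ _)) (s≤s ())

  onWalk≤1⇒endpoint : ∀ {u v l x} (p : Walk Adj u v l) → l ≤ 1 → OnWalk Adj x p → x ≡ u ⊎ x ≡ v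
  onWalk≤1⇒endpoint nil _ here = inj₁ refl
  onWalk≤1⇒endpoint (cons _ nil) _ here = inj₁ refl
  onWalk≤1⇒endpoint (cons _ nil) _ (there here) = inj₂ refl
  onWalk≤1⇒endpoint (cons _ (cons _ _)) (s≤s ()) _

module _ {V : Set} (Adj : V → V → Set) where

  NimDNG-unique : ∀ f P {g g′} → NimDNG Adj f P g → NimDNG Adj f P g′ → g ≡ g′
  NimDNG-unique zero P (lift g≡0) (lift g′≡0) = trans g≡0 (sym g′≡0)
  NimDNG-unique (suc f) P {g} {g′} (avoid , reach) (avoid′ , reach′) with <-cmp g g′
  ... | tri≈ _ g≡g′ _ = g≡g′
  ... | tri< g<g′ _ _ = let (v , move , nim) = reach′ g g<g′ in ⊥-elim (avoid v move g nim refl)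
  ... | tri> _ _ g>g′ = let (v , move , nim) = reach g′ g>g′ in ⊥-elim (avoid′ v move g′ nim refl)

  module FixedLength (Reachable : List V → Set) (n : ℕ)
    (move-preserves : ∀ {P v} → Reachable P → DNGMove Adj P v → Reachable (v ∷ P))
    (length-bound : ∀ {P} → Reachable P → length P ≤ n)
    (move-exists : ∀ {P} → Reachable P → length P < n → ∃ λ v → DNGMove Adj P v)
    where

    NimDNG-remaining : ∀ f P r → Reachable P → length P + r ≡ n → r ≤ f → NimDNG Adj f P (pty r)
    NimDNG-remaining zero P zero _ _ _ = lift refl
    NimDNG-remaining (suc f) P zero R len≡ _ = no-move , λ h ()
      where
        no-move : ∀ v → DNGMove Adj P v → ∀ h → NimDNG Adj f (v ∷ P) h → h ≢ 0
        no-move v move _ _ _ =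
          <-irrefl refl (subst (length P <_) (trans (sym len≡) (+-identityʳ _))
                          (length-bound (move-preserves R move)))
    NimDNG-remaining (suc f) P (suc r) R len≡ (s≤s r≤f) = option-values-differ , option-reaching
      where
        len′≡ : ∀ v → length (v ∷ P) + r ≡ n
        len′≡ v = trans (sym (+-suc (length P) r)) len≡

        option-values-differ : ∀ v → DNGMove Adj P v → ∀ h → NimDNG Adj f (v ∷ P) h → h ≢ pty (suc r)
        option-values-differ v move h nim h≡ = pty-suc≢ r (trans (sym h≡) h≡pty)
          where
            h≡pty : h ≡ pty r
            h≡pty = NimDNG-unique f (v ∷ P) nim
              (NimDNG-remaining f (v ∷ P) r (move-preserves R move) (len′≡ v) r≤f)

        option-reaching : ∀ h → h < pty (suc r) → Σ V λ v → DNGMove Adj P v × NimDNG Adj f (v ∷ P) h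
        option-reaching h h< with move-exists R (subst (length P <_) len≡ (m<m+n (length P) (s≤s z≤n)))
        ... | v , move = v , move , subst (NimDNG Adj f (v ∷ P)) (sym (<pty-suc⇒≡pty r h<))
                (NimDNG-remaining f (v ∷ P) r (move-preserves R move) (len′≡ v) r≤f)

length≤order : ∀ {ms} → All (1 ≤_) ms → length ms ≤ order ms
length≤order All.[] = z≤n
length≤order (1≤m All.∷ nonempty) = +-mono-≤ 1≤m (length≤order nonempty)

lam+sigma≡length : ∀ {ms} → All (1 ≤_) ms → lam ms + sigma ms ≡ length ms
lam+sigma≡length All.[] = refl
lam+sigma≡length {suc zero ∷ ms} (_ All.∷ nonempty) =
  trans (+-suc (lam ms) (sigma ms)) (cong suc (lam+sigma≡length nonempty))
lam+sigma≡length {suc (suc _) ∷ _} (_ All.∷ nonempty) = cong suc (lam+sigma≡length nonempty)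

1≤lam⇒∃-big : ∀ ms → 1 ≤ lam ms → ∃ λ i → 2 ≤ lookup ms i
1≤lam⇒∃-big (zero ∷ ms) 1≤lam = let (i , big) = 1≤lam⇒∃-big ms 1≤lam in fsuc i , big
1≤lam⇒∃-big (suc zero ∷ ms) 1≤lam = let (i , big) = 1≤lam⇒∃-big ms 1≤lam in fsuc i , big
1≤lam⇒∃-big (suc (suc _) ∷ _) _ = fzero , s≤s (s≤s z≤n)

2≤lam⇒∃-twoBig : ∀ ms → 2 ≤ lam ms → ∃₂ λ i j → i ≢ j × 2 ≤ lookup ms i × 2 ≤ lookup ms j
2≤lam⇒∃-twoBig (zero ∷ ms) 2≤lam with 2≤lam⇒∃-twoBig ms 2≤lam
... | i , j , i≢j , bigs = fsuc i , fsuc j , (λ eq → i≢j (suc-injective eq)) , bigs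
2≤lam⇒∃-twoBig (suc zero ∷ ms) 2≤lam with 2≤lam⇒∃-twoBig ms 2≤lam
... | i , j , i≢j , bigs = fsuc i , fsuc j , (λ eq → i≢j (suc-injective eq)) , bigs
2≤lam⇒∃-twoBig (suc (suc _) ∷ ms) (s≤s 1≤lam) with 1≤lam⇒∃-big ms 1≤lam
... | j , big = fzero , fsuc j , (λ ()) , s≤s (s≤s z≤n) , big

module Multipartite (ms : List ℕ) where

  private
    V : Set
    V = CMVertex ms

    Adj : V → V → Set
    Adj = CMAdj ms

  Part : Set
  Part = Fin (length ms)

  part : V → Part
  part = proj₁

  Big : Part → Set
  Big i = 2 ≤ lookup ms i

  BigBesides : Set
  BigBesides = ∀ i → ∃ λ j → j ≢ i × Big j

  twoBig⇒BigBesides : ∀ {i j} → i ≢ j → Big i → Big j → BigBesides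
  twoBig⇒BigBesides {i} {j} i≢j bigᵢ bigⱼ p with i ≟ p
  ... | yes refl = j , (λ j≡i → i≢j (sym j≡i)) , bigⱼ
  ... | no i≢p = i , i≢p , bigᵢ

  big⇒∃-distinct : ∀ {i} → Big i → ∃₂ λ u v → part u ≡ i × part v ≡ i × u ≢ v
  big⇒∃-distinct {i} big with 2≤⇒∃-distinct big
  ... | a , b , a≢b = (i , a) , (i , b) , refl , refl , λ { refl → a≢b refl }

  -- u, y, v is a geodesic: u and v are distinct and non-adjacent.
  convex-samePart⇒otherParts : ∀ {C : V → Set} → Convex Adj C → ∀ {u v} → C u → C v →
    part u ≡ part v → u ≢ v → ∀ y → part y ≢ part u → C y
  convex-samePart⇒otherParts convex {u} {v} Cu Cv same u≢v y y∉ =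
    convex u v Cu Cv u-y-v shortest y (there here)
    where
      u-y-v : Walk Adj u v 2
      u-y-v = cons (λ u≡y → y∉ (sym u≡y)) (cons (λ y≡v → y∉ (trans y≡v (sym same))) nil)

      shortest : IsShortest Adj u-y-v
      shortest {l} w with 2 ≤? l
      ... | yes 2≤l = 2≤l
      ... | no 2≰l with walk≤1⇒≡⊎Adj w (≤-pred (≰⇒> 2≰l))
      ...   | inj₁ u≡v = ⊥-elim (u≢v u≡v)
      ...   | inj₂ adj = ⊥-elim (adj same)

  convex-samePart⇒full : BigBesides → ∀ {C : V → Set} → Convex Adj C →
    ∀ {u v} → C u → C v → part u ≡ part v → u ≢ v → ∀ x → C x
  convex-samePart⇒full bigBesides {C} convex {u} Cu Cv same u≢v = everywhere (bigBesides (part u))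
    where
      outside : ∀ y → part y ≢ part u → C y
      outside = convex-samePart⇒otherParts convex Cu Cv same u≢v

      everywhere : (∃ λ j → j ≢ part u × Big j) → ∀ x → C x
      everywhere (j , j≢ , big) x with part x ≟ j | big⇒∃-distinct big
      ... | yes x∈j | _ = outside x (λ x∈u → j≢ (trans (sym x∈j) x∈u))
      ... | no x∉j | a , b , a∈j , b∈j , a≢b =
        convex-samePart⇒otherParts convex
          (outside a (λ a∈u → j≢ (trans (sym a∈j) a∈u)))
          (outside b (λ b∈u → j≢ (trans (sym b∈j) b∈u)))
          (trans a∈j (sym b∈j)) a≢b x (λ x∈a → x∉j (trans x∈a a∈j))

  samePart⇒Generating : BigBesides → ∀ {P u v} → u ∈ P → v ∈ P →
    part u ≡ part v → u ≢ v → Generating Adj P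
  samePart⇒Generating bigBesides u∈P v∈P same u≢v C convex P⊆C =
    convex-samePart⇒full bigBesides convex (P⊆C _ u∈P) (P⊆C _ v∈P) same u≢v

  Transversal : List V → Set
  Transversal P = Injective _≡_ _≡_ (λ i → part (lookup P i))

  transversal-[] : Transversal []
  transversal-[] {()}

  transversal-∷ : ∀ {P v} → Transversal P → (∀ j → part (lookup P j) ≢ part v) → Transversal (v ∷ P)
  transversal-∷ _ _ {fzero} {fzero} _ = refl
  transversal-∷ _ new {fzero} {fsuc j} same = ⊥-elim (new j (sym same))
  transversal-∷ _ new {fsuc i} {fzero} same = ⊥-elim (new i same)
  transversal-∷ transversal _ {fsuc i} {fsuc j} same = cong fsuc (transversal same)

  transversal-samePart⇒≡ : ∀ {P} → Transversal P → ∀ {u v} → u ∈ P → v ∈ P → part u ≡ part v → u ≡ v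
  transversal-samePart⇒≡ {P} transversal u∈P v∈P same =
    trans (lookup-index u∈P) (trans (cong (lookup P) (transversal same′)) (sym (lookup-index v∈P)))
    where
      same′ : part (lookup P (index u∈P)) ≡ part (lookup P (index v∈P))
      same′ = trans (cong part (sym (lookup-index u∈P))) (trans same (cong part (lookup-index v∈P)))

  transversal-≡⊎Adj : ∀ {Q} → Transversal Q → ∀ {u v} → u ∈ Q → v ∈ Q → u ≡ v ⊎ Adj u v
  transversal-≡⊎Adj transversal {u} {v} u∈Q v∈Q with part u ≟ part v
  ... | yes same = inj₁ (transversal-samePart⇒≡ transversal u∈Q v∈Q same)
  ... | no differ = inj₂ differ

  transversal-convex : ∀ {Q} → Transversal Q → Convex Adj (_∈ Q)
  transversal-convex transversal u v u∈Q v∈Q p shortest x onP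
    with onWalk≤1⇒endpoint p (shortest≤1 p (transversal-≡⊎Adj transversal u∈Q v∈Q) shortest) onP
  ... | inj₁ refl = u∈Q
  ... | inj₂ refl = v∈Q

  transversal-¬Generating : ∀ {i} → Big i → ∀ {Q} → Transversal Q → ¬ Generating Adj Q
  transversal-¬Generating big transversal generating with big⇒∃-distinct big
  ... | a , b , a∈i , b∈i , a≢b = a≢b (transversal-samePart⇒≡ transversal (everything a) (everything b)
                                      (trans a∈i (sym b∈i)))
    where
      everything : ∀ x → x ∈ _
      everything = generating (_∈ _) (transversal-convex transversal) (λ _ x∈Q → x∈Q)

  move-preserves-transversal : BigBesides → ∀ {P v} → Transversal P →
    DNGMove Adj P v → Transversal (v ∷ P)
  move-preserves-transversal bigBesides {P} {v} transversal (v∉P , ¬generating) =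
    transversal-∷ transversal λ j same → ¬generating
      (samePart⇒Generating bigBesides (there (∈-lookup j)) (here refl) same
        (λ lookup≡v → v∉P (subst (_∈ P) lookup≡v (∈-lookup j))))

  transversal-length≤ : ∀ {P} → Transversal P → length P ≤ length ms
  transversal-length≤ = injective⇒≤

  transversal-extendable : All (1 ≤_) ms → ∀ {i} → Big i → ∀ {P} → Transversal P →
    length P < length ms → ∃ λ v → DNGMove Adj P v
  transversal-extendable nonempty big {P} transversal shorter
    with <⇒∃-outsideImage shorter (λ j → part (lookup P j))
  ... | i , unhit = v , v∉P , transversal-¬Generating big (transversal-∷ transversal unhit)
    where
      v : V
      v = i , fromℕ< (All.lookup nonempty (∈-lookup i))

      v∉P : v ∉ P
      v∉P v∈P = unhit (index v∈P) (cong part (sym (lookup-index v∈P)))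

  NimDNGCM-length : All (1 ≤_) ms → (∃₂ λ i j → i ≢ j × Big i × Big j) →
    NimDNGCM ms (pty (length ms))
  NimDNGCM-length nonempty (i , j , i≢j , bigᵢ , bigⱼ) =
    NimDNG-remaining (order ms) [] (length ms) transversal-[] refl (length≤order nonempty)
    where
      open FixedLength Adj Transversal (length ms)
        (move-preserves-transversal (twoBig⇒BigBesides i≢j bigᵢ bigⱼ))
        (λ {P} → transversal-length≤ {P}) (transversal-extendable nonempty bigᵢ)

proposition7p19 : (ms : List ℕ) → 2 ≤ length ms → All (1 ≤_) ms → Sorted ms →
    2 ≤ lam ms → NimDNGCM ms (pty (lam ms + sigma ms))
proposition7p19 ms _ nonempty _ 2≤lam =
  subst (NimDNGCM ms) (cong pty (sym (lam+sigma≡length nonempty)))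
    (Multipartite.NimDNGCM-length ms nonempty (2≤lam⇒∃-twoBig ms 2≤lam))
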